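{- Let $\mathsf{V}$ be a quantale, $T$ a set endofunctor, and $\Gamma$ a $\mathsf{V}$-relator for $T$ that is compatible with $\varphi$. Let $f:X\to TZ$ and $g:Y\to TW$ be functions. (1) If $\alpha:X\nrightarrow Y$ and $\beta:Z\nrightarrow W$ are $\mathsf{V}$-relations with $\alpha(x,y)\leq\Gamma\beta(f(x),g(y))$ for all $x\in X,y\in Y$, then $(\varphi\circ\alpha)(x,y)\leq\Delta_\Gamma(\varphi\circ\beta)(f(x),g(y))$ for all $x\in X,y\in Y$. (2) If $\mathcal{R}:X\nrightarrow Y$ and $\mathcal{S}:Z\nrightarrow W$ are $\mathsf{2}$-relations with $\mathcal{R}(x,y)\leq\Delta_\Gamma\mathcal{S}(f(x),g(y))$ for all $x\in X,y\in Y$, then $(\psi\circ\mathcal{R})(x,y)\leq\Gamma(\psi\circ\mathcal{S})(f(x),g(y))$ for all $x\in X,y\in Y$.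
   Context: A quantale $(\mathsf{V},\leq,\otimes,k)$ is a complete lattice with a monoid structure whose multiplication distributes over arbitrary joins; it is assumed commutative, non-trivial and integral ($k$ is the top element); $\bot$ is its bottom. $\mathsf{2}=\{\mathsf{false}\leq\mathsf{true}\}$ is the boolean quantale (multiplication $\wedge$, unit $\mathsf{true}$). A $\mathsf{V}$-relation $\alpha:X\nrightarrow Y$ is a function $X\times Y\to\mathsf{V}$; a $\mathsf{2}$-relation is an ordinary relation. Composition: $(\beta\cdot\alpha)(x,z)=\bigvee_y\alpha(x,y)\otimes\beta(y,z)$; identity maps diagonal pairs to $k$ and others to $\bot$; dual $\alpha^{\circ}(y,x)=\alpha(x,y)$; functions are $\mathsf{V}$-relations via their graph ($k$ on the graph, $\bot$ elsewhere). A $\mathsf{V}$-relator for $T$ assigns to each $\alpha:X\nrightarrow Y$ a $\mathsf{V}$-relation $\Gamma\alpha:TX\nrightarrow TY$ with: $1_{TX}\leq\Gamma(1_X)$; $\Gamma\beta\cdot\Gamma\alpha\leq\Gamma(\beta\cdot\alpha)$; $Tf\leq\Gamma f$ and $(Tf)^{\circ}\leq\Gamma(f^{\circ})$ for functions $f$; $\alpha\leq\beta\Rightarrow\Gamma\alpha\leq\Gamma\beta$. Define $\varphi:\mathsf{V}\to\mathsf{2}$ by $\varphi(k)=\mathsf{true}$ and $\varphi(a)=\mathsf{false}$ for $a\neq k$, and $\psi:\mathsf{2}\to\mathsf{V}$ by $\psi(\mathsf{true})=k$, $\psi(\mathsf{false})=\bot$. For a map $h$ and a relation $\alpha$, $h\circ\alpha$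 denotes $(x,y)\mapsto h(\alpha(x,y))$. The $\mathsf{2}$-relator induced by $\Gamma$ is $\Delta_\Gamma\mathcal{R}:=\varphi\circ\Gamma(\psi\circ\mathcal{R})$. $\Gamma$ is compatible with $\varphi$ if $\Delta_\Gamma(\varphi\circ\alpha)=\varphi\circ\Gamma\alpha$ for every $\mathsf{V}$-relation $\alpha$. -}

module Defs where

open import Level using (Level)
open import Data.Empty using (⊥)
open import Data.Product using (_×_)
open import Relation.Nullary using (¬_)
open import Relation.Binary.PropositionalEquality using (_≡_)
open import Function using (_∘_; id)

record Quantale : Set₁ where
  infix  4 _≤_
  infixl 7 _⊗_
  field
    Carrier   : Set
    _≤_       : Carrier → Carrier → Set
    ≤-refl    : ∀ {a} → a ≤ a
    ≤-trans   : ∀ {a b c} → a ≤ b → b ≤ c → a ≤ c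
    ≤-antisym : ∀ {a b} → a ≤ b → b ≤ a → a ≡ b
    ⋁         : {I : Set} → (I → Carrier) → Carrier
    ⋁-upper   : ∀ {I : Set} (h : I → Carrier) (i : I) → h i ≤ ⋁ h
    ⋁-least   : ∀ {I : Set} (h : I → Carrier) (a : Carrier) →
                (∀ i → h i ≤ a) → ⋁ h ≤ a
    _⊗_       : Carrier → Carrier → Carrier
    k         : Carrier
    ⊗-assoc   : ∀ a b c → (a ⊗ b) ⊗ c ≡ a ⊗ (b ⊗ c)
    ⊗-comm    : ∀ a b → a ⊗ b ≡ b ⊗ a
    ⊗-identityˡ : ∀ a → k ⊗ a ≡ a
    ⊗-distrib-⋁ : ∀ {I : Set} (a : Carrier) (h : I → Carrier) →
                  a ⊗ ⋁ h ≡ ⋁ (λ i → a ⊗ h i)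
    integral  : ∀ a → a ≤ k

  ⊥V : Carrier
  ⊥V = ⋁ {⊥} (λ ())

  field
    nontrivial : ¬ (k ≡ ⊥V)

record SetFunctor : Set₁ where
  field
    F      : Set → Set
    fmap   : ∀ {A B : Set} → (A → B) → F A → F B
    fmap-id : ∀ {A : Set} (t : F A) → fmap id t ≡ t
    fmap-∘  : ∀ {A B C : Set} (g : B → C) (h : A → B) (t : F A) →
              fmap (g ∘ h) t ≡ fmap g (fmap h t)

module VRelations (V : Quantale) where
  open Quantale V

  infix 4 _≤ʳ_
  infixr 9 _·_
  infix 10 _°

  VRel : Set → Set → Set
  VRel X Y = X → Y → Carrier

  _≤ʳ_ : ∀ {X Y} → VRel X Y → VRel X Y → Set
  α ≤ʳ β = ∀ x y → α x y ≤ β x y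

  _·_ : ∀ {X Y Z} → VRel Y Z → VRel X Y → VRel X Z
  (β · α) x z = ⋁ (λ y → α x y ⊗ β y z)

  _° : ∀ {X Y} → VRel X Y → VRel Y X
  (α °) y x = α x y

  -- graph of a function: k on the graph, ⊥ elsewhere
  -- (written as the join of k over proofs of f x ≡ y)
  graph : ∀ {X Y} → (X → Y) → VRel X Y
  graph f x y = ⋁ {f x ≡ y} (λ _ → k)

  1ʳ : ∀ X → VRel X X
  1ʳ X = graph id

record Relator (V : Quantale) (T : SetFunctor) : Set₁ where
  open VRelations V
  open SetFunctor T
  field
    Γ      : ∀ {X Y : Set} → VRel X Y → VRel (F X) (F Y)
    Γ-id   : ∀ {X : Set} → 1ʳ (F X) ≤ʳ Γ (1ʳ X)
    Γ-comp : ∀ {X Y Z : Set} (α : VRel X Y) (β : VRel Y Z) →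
             (Γ β · Γ α) ≤ʳ Γ (β · α)
    Γ-fun  : ∀ {X Y : Set} (f : X → Y) → graph (fmap f) ≤ʳ Γ (graph f)
    Γ-fun° : ∀ {X Y : Set} (f : X → Y) →
             (graph (fmap f)) ° ≤ʳ Γ ((graph f) °)
    Γ-mono : ∀ {X Y : Set} (α β : VRel X Y) → α ≤ʳ β → Γ α ≤ʳ Γ β

-- The boolean quantale 2 is rendered as propositions (Set); its order
-- is implication.  2-relations are proof-relevant ordinary relations.

Rel₂ : Set → Set → Set₁
Rel₂ X Y = X → Y → Set

module PhiPsi (V : Quantale) where
  open Quantale V
  open VRelations V

  φ : Carrier → Set
  φ a = a ≡ k

  -- ψ(true) = k, ψ(false) = ⊥  (join of k over proofs of P)
  ψ : Set → Carrier
  ψ P = ⋁ {P} (λ _ → k)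

  φ∘ : ∀ {X Y} → VRel X Y → Rel₂ X Y
  φ∘ α x y = φ (α x y)

  ψ∘ : ∀ {X Y} → Rel₂ X Y → VRel X Y
  ψ∘ R x y = ψ (R x y)

module Induced {V : Quantale} {T : SetFunctor} (Rl : Relator V T) where
  open Quantale V
  open VRelations V
  open PhiPsi V
  open SetFunctor T
  open Relator Rl

  Δ : ∀ {X Y : Set} → Rel₂ X Y → Rel₂ (F X) (F Y)
  Δ R = φ∘ (Γ (ψ∘ R))

  -- compatibility with φ: Δ_Γ (φ∘α) = φ∘Γα  (equality in 2 = logical equivalence)
  Compatible : Set₁
  Compatible = ∀ {X Y : Set} (α : VRel X Y) (a : F X) (b : F Y) →
               (Δ (φ∘ α) a b → φ (Γ α a b)) × (φ (Γ α a b) → Δ (φ∘ α) a b)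

module Submission where

-- Both halves reduce to two
-- elementary facts about the maps φ : V → 2 and ψ : 2 → V:
--
--  * φ is monotone, because k is the top element (integrality): if a ≤ b
--    and a = k then b = k;
--  * ψ P ≤ b as soon as P implies b = k, because ψ P is a join of copies
--    of k indexed by proofs of P.
--
-- Part (1) pushes α(x,y) ≤ Γβ(fx,gy) through the monotone φ and then uses
-- compatibility with φ to rewrite φ∘Γβ as Δ_Γ(φ∘β).  Part (2) needs no
-- compatibility: Δ_Γ S (fx,gy) says precisely that Γ(ψ∘S)(fx,gy) = k, so the
-- second fact about ψ applies directly.

open import Defs
open import Data.Product using (_×_; _,_; proj₂)
open import Relation.Binary.PropositionalEquality using (subst; sym)

module PhiPsiProperties (V : Quantale) where
  open Quantale V
  open PhiPsi V

  -- φ is monotone: an element above k is k itself, since k is the top.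
  φ-mono : ∀ {a b} → a ≤ b → φ a → φ b
  φ-mono {b = b} a≤b a≡k =
    ≤-antisym (integral b) (subst (λ c → c ≤ b) a≡k a≤b)

  -- ψ P lies below every b that P forces to equal k (ψ P is a join of k's).
  ψ-least : ∀ {P : Set} {b : Carrier} → (P → φ b) → ψ P ≤ b
  ψ-least {b = b} P⇒b≡k =
    ⋁-least (λ _ → k) b (λ p → subst (k ≤_) (sym (P⇒b≡k p)) ≤-refl)

module Transfer {V : Quantale} {T : SetFunctor} (Rl : Relator V T) where
  open Quantale V
  open VRelations V
  open PhiPsi V
  open SetFunctor T
  open Relator Rl
  open Induced Rl
  open PhiPsiProperties V

  φ-transfer : Compatible →
    {X Y Z W : Set} (f : X → F Z) (g : Y → F W) (α : VRel X Y) (β : VRel Z W) →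
    (∀ x y → α x y ≤ Γ β (f x) (g y)) →
    ∀ x y → φ∘ α x y → Δ (φ∘ β) (f x) (g y)
  φ-transfer compatible f g α β α≤Γβ x y φα =
    proj₂ (compatible β (f x) (g y)) (φ-mono (α≤Γβ x y) φα)

  -- Part (2): a 2-simulation R ⊆ Δ_Γ S ∘ (f × g) yields the V-simulation
  -- ψ∘R ≤ Γ(ψ∘S) ∘ (f × g); Δ_Γ S (f x) (g y) says Γ(ψ∘S)(f x)(g y) = k.
  ψ-transfer : {X Y Z W : Set} (f : X → F Z) (g : Y → F W) (R : Rel₂ X Y) (S : Rel₂ Z W) →
    (∀ x y → R x y → Δ S (f x) (g y)) →
    ∀ x y → ψ∘ R x y ≤ Γ (ψ∘ S) (f x) (g y)
  ψ-transfer f g R S R⇒ΔS x y = ψ-least (R⇒ΔS x y)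

lemma4p14 : (V : Quantale) (T : SetFunctor) (Rl : Relator V T) →
    Induced.Compatible Rl →
    {X Y Z W : Set} (f : X → SetFunctor.F T Z) (g : Y → SetFunctor.F T W) →
    ((α : VRelations.VRel V X Y) (β : VRelations.VRel V Z W) →
    (∀ x y → Quantale._≤_ V (α x y) (Relator.Γ Rl β (f x) (g y))) →
    ∀ x y → PhiPsi.φ∘ V α x y → Induced.Δ Rl (PhiPsi.φ∘ V β) (f x) (g y))
    ×
    ((R : Rel₂ X Y) (S : Rel₂ Z W) →
    (∀ x y → R x y → Induced.Δ Rl S (f x) (g y)) →
    ∀ x y → Quantale._≤_ V (PhiPsi.ψ∘ V R x y) (Relator.Γ Rl (PhiPsi.ψ∘ V S) (f x) (g y)))
lemma4p14 V T Rl compatible f g =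
  Transfer.φ-transfer Rl compatible f g , Transfer.ψ-transfer Rl f g
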